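{- For every $d\ge 1$ there is a bounded parity game with costs $\mathcal{G}_d$ such that: the arena of $\mathcal{G}_d$ has size linear in $d$ and $\mathcal{G}_d$ has exactly $d$ odd colors; Player $1$ has a uniform finite-state winning strategy for $\mathcal{G}_d$ that is winning from every vertex and is implemented with $d+1$ memory states; but there is a vertex from which Player $1$ has no winning strategy implemented with fewer than $d+1$ memory states.
   Context: An arena is a tuple $\mathcal{A}=(V,V_0,V_1,E)$ where $(V,E)$ is a finite directed graph in which every vertex has at least one outgoing edge, and $\{V_0,V_1\}$ is a partition of $V$. A play is an infinite path $\rho=\rho_0\rho_1\cdots$ in $(V,E)$. A game $(\mathcal{A},\mathrm{Win})$ has Player $0$ winning the plays in $\mathrm{Win}\subseteq V^\omega$ and Player $1$ the others. A strategy for Player $i$ is a map $\sigma:V^*V_i\to V$ with $(v,\sigma(wv))\in E$; a play is consistent with $\sigma$ if $\rho_{n+1}=\sigma(\rho_0\cdots\rho_n)$ whenever $\rho_n\in V_i$; it is winning from $W$ if all consistent plays starting in $W$ are won by Player $i$; $W_i(\mathcal{G})$ is the set of vertices from which Player $i$ has a winning strategy; a strategy is uniform if it is winning from every vertex of $W_i(\mathcal{G})$. A memory structure is $\mathcal{M}=(M,\mathrm{Init},\mathrm{Upd})$ with $M$ finite, $\mathrm{Init}:V\to M$, $\mathrm{Upd}:M\times V\to M$, extended by $\mathrm{Upd}^+(\rho_0)=\mathrm{Init}(\rho_0)$, $\mathrm{Upd}^+(wv)=\mathrm{Upd}(\mathrm{Upd}^+(w),v)$; with a next-move function $\mathrm{Nxt}:V_i\times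 M\to V$ (with $(v,\mathrm{Nxt}(v,m))\in E$) it implements $\sigma(\rho_0\cdots\rho_n)=\mathrm{Nxt}(\rho_n,\mathrm{Upd}^+(\rho_0\cdots\rho_n))$, a finite-state strategy with $|M|$ memory states. A cost function is $\mathrm{Cst}:E\to\{\epsilon,i\}$; edges labelled $i$ are increment-edges; the cost of a path is the number of increment-edges it traverses. A coloring is $\Omega:V\to\mathbb{N}$; $\mathrm{Ans}(c)=\{c'\in\mathbb{N}:c'\ge c,\ c'\text{ even}\}$. For a play $\rho$ and position $k$ let $\mathrm{Cor}(\rho,k)=\min\{\mathrm{Cst}(\rho_k\cdots\rho_{k'}):k'\ge k,\ \Omega(\rho_{k'})\in\mathrm{Ans}(\Omega(\rho_k))\}$ ($\min\emptyset=\infty$); the request at $k$ is unanswered with cost $\infty$ if the set is empty and infinitely many increment-edges are traversed after $k$. A bounded parity game with costs is $(\mathcal{A},\mathrm{BndCostParity}(\Omega,\mathrm{Cst}))$ where $\mathrm{BndCostParity}(\Omega,\mathrm{Cst})$ is the set of plays with $\limsup_{k\to\infty}\mathrm{Cor}(\rho,k)<\infty$ containing no request unanswered with cost $\infty$. The odd colors of the game are the odd elements of $\Omega(V)$. -}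

module Defs where

open import Data.Nat using (ℕ; zero; suc; _+_; _*_; _∸_; _≤_; _<_)
open import Data.Nat.Divisibility using (_∣_)
open import Data.Fin using (Fin)
open import Data.Bool using (Bool; true; false; if_then_else_)
open import Data.List using (List; []; _∷_; _++_; [_]; map; upTo; allFin; length; foldl)
open import Data.Nat.ListAction using (sum)
open import Data.List.Membership.Propositional using (_∈_)
open import Data.List.Relation.Unary.Unique.Propositional using (Unique)
open import Data.Product using (Σ; ∃; _×_; _,_)
open import Relation.Nullary using (¬_)
open import Relation.Binary.PropositionalEquality using (_≡_)

data Player : Set where
  P0 P1 : Player

data CostLabel : Set where
  ε incr : CostLabel

-- A bounded parity game with costs: arena on vertex set Fin n,
-- edge relation given as a Boolean adjacency function,
-- coloring Ω and cost function Cst (only its values on edges matter).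
record Game : Set where
  field
    n     : ℕ
    owner : Fin n → Player
    edge  : Fin n → Fin n → Bool
    total : ∀ v → Σ (Fin n) (λ u → edge v u ≡ true)
    Ω     : Fin n → ℕ
    Cst   : Fin n → Fin n → CostLabel

module _ (G : Game) where
  open Game G

  V : Set
  V = Fin n

  numEdges : ℕ
  numEdges = sum (map (λ v → sum (map (λ u → if edge v u then 1 else 0) (allFin n))) (allFin n))

  arenaSize : ℕ
  arenaSize = n + numEdges

  Even : ℕ → Set
  Even c = 2 ∣ c

  Odd : ℕ → Set
  Odd c = ¬ (2 ∣ c)

  Ans : ℕ → ℕ → Set
  Ans c c' = (c ≤ c') × Even c'

  HasOddColorCount : ℕ → Set
  HasOddColorCount d =
    Σ (List ℕ) λ L → (length L ≡ d) × Unique L ×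
      (∀ c → (c ∈ L → Odd c × ∃ (λ v → Ω v ≡ c)) × (Odd c × ∃ (λ v → Ω v ≡ c) → c ∈ L))

  IsPlay : (ℕ → V) → Set
  IsPlay ρ = ∀ k → edge (ρ k) (ρ (suc k)) ≡ true

  costOf : CostLabel → ℕ
  costOf ε    = 0
  costOf incr = 1

  costFrom : (ℕ → V) → ℕ → ℕ → ℕ
  costFrom ρ k zero    = 0
  costFrom ρ k (suc l) = costOf (Cst (ρ k) (ρ (suc k))) + costFrom ρ (suc k) l

  segCost : (ℕ → V) → ℕ → ℕ → ℕ
  segCost ρ k k' = costFrom ρ k (k' ∸ k)

  -- Cor(ρ,k) ≤ b
  CorLe : (ℕ → V) → ℕ → ℕ → Set
  CorLe ρ k b = ∃ λ k' → (k ≤ k') × Ans (Ω (ρ k)) (Ω (ρ k')) × (segCost ρ k k' ≤ b)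

  -- limsup_{k→∞} Cor(ρ,k) < ∞
  LimsupCorFinite : (ℕ → V) → Set
  LimsupCorFinite ρ = ∃ λ b → ∃ λ N → ∀ k → N ≤ k → CorLe ρ k b

  -- the request at k is unanswered with cost ∞
  UnansweredInf : (ℕ → V) → ℕ → Set
  UnansweredInf ρ k =
    (∀ k' → k ≤ k' → ¬ Ans (Ω (ρ k)) (Ω (ρ k'))) ×
    (∀ m → ∃ λ j → (m ≤ j) × (k ≤ j) × (Cst (ρ j) (ρ (suc j)) ≡ incr))

  BndCostParity : (ℕ → V) → Set
  BndCostParity ρ = LimsupCorFinite ρ × (∀ k → ¬ UnansweredInf ρ k)

  -- strategies for Player 1: σ(w v) for history w and current vertex v ∈ V₁
  record Strategy₁ : Set where
    field
      σ     : List V → V → V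
      legal : ∀ w v → owner v ≡ P1 → edge v (σ w v) ≡ true

  prefix : (ℕ → V) → ℕ → List V
  prefix ρ k = map ρ (upTo k)

  Consistent₁ : Strategy₁ → (ℕ → V) → Set
  Consistent₁ s ρ = ∀ k → owner (ρ k) ≡ P1 → ρ (suc k) ≡ Strategy₁.σ s (prefix ρ k) (ρ k)

  WinningFrom₁ : Strategy₁ → V → Set
  WinningFrom₁ s v = ∀ ρ → IsPlay ρ → ρ 0 ≡ v → Consistent₁ s ρ → ¬ BndCostParity ρ

  record Memory₁ (m : ℕ) : Set where
    field
      Init : V → Fin m
      Upd  : Fin m → V → Fin m
      Nxt  : V → Fin m → V
      Nxt-legal : ∀ v x → owner v ≡ P1 → edge v (Nxt v x) ≡ true

    Upd⁺ : List V → V → Fin m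
    Upd⁺ []      v = Init v
    Upd⁺ (x ∷ w) v = foldl Upd (Init x) (w ++ [ v ])

  implemented : ∀ {m} → Memory₁ m → Strategy₁
  implemented 𝓜 = record
    { σ     = λ w v → Nxt v (Upd⁺ w v)
    ; legal = λ w v p → Nxt-legal v (Upd⁺ w v) p }
    where open Memory₁ 𝓜

-- In 𝒢 d Player 0 repeatedly picks a hub i; Player 1 answers either by paying an increment
-- through pay i (colour 2i) or by passing reset i (colour 2d, which answers every request) on
-- the way to request i (colour 2i+1).
-- Player 1 wins with memory {0, …, d} holding the last request j (0 for none): at hub i he pays
-- iff i ≤ j. Every reset opens a strictly larger request, so eventually Player 0 only picks
-- hubs i ≤ j, and from then on the request 2j+1 stays open while increments are paid forever.
-- Against m ≤ d memory states, assign to each state s the first hub at which Player 1, entering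
-- it from s, does not pay. This value lies in {0, …, d}, so some g is assigned to no state.
-- Player 0 then picks the first non-paying hub h < g or the paying hub g. Hence every request
-- is some 2h+1 with h < g and is answered three steps later by colour 2d or 2g.

module Submission where

open import Defs
open import Data.Nat
  using (ℕ; zero; suc; _+_; _*_; _≤_; _<_; z≤n; s≤s; s≤s⁻¹; z<s; s<s; _<?_; NonZero; >-nonZero⁻¹)
open import Data.Nat.Properties
open import Data.Nat.Divisibility using (_∣_; ∣m+n∣m⇒∣n; m∣m*n; >⇒∤)
open import Data.Nat.ListAction using (sum)
open import Data.Nat.Solver using (module +-*-Solver)
open import Data.Fin as Fin using (Fin; zero; suc; toℕ; fromℕ<; _↑ˡ_; _↑ʳ_; splitAt)
open import Data.Fin.Induction using (>-wellFounded)
open import Data.Fin.Properties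
  using (toℕ<n; toℕ-injective; injective⇒≤; ¬∀⟶∃¬; any?; splitAt-↑ˡ; splitAt-↑ʳ; splitAt⁻¹-↑ˡ; splitAt⁻¹-↑ʳ)
  renaming (_≟_ to _≟ᶠ_; 0≢1+n to zero≢suc)
open import Data.List using (List; []; _∷_; [_]; _∷ʳ_; map; applyUpTo; allFin; length; tabulate)
open import Data.List.Properties
  using (foldl-∷ʳ; applyUpTo-∷ʳ; map-applyUpTo; map-tabulate; length-map; length-tabulate)
open import Data.List.Membership.Propositional using (_∈_)
open import Data.List.Membership.Propositional.Properties using (∈-map⁺; ∈-map⁻; ∈-allFin)
open import Data.List.Relation.Unary.Any using (here; there)
open import Data.List.Relation.Unary.Any.Properties using (singleton⁻)
open import Data.List.Relation.Unary.Unique.Propositional.Properties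
  using (allFin⁺) renaming (map⁺ to Unique-map⁺)
open import Data.Bool using (Bool; true; false; if_then_else_; not; _∧_)
open import Data.Product using (Σ; ∃; _×_; _,_; proj₁; proj₂)
open import Data.Sum as Sum using (_⊎_; inj₁; inj₂; [_,_]′)
open import Data.Unit using (⊤; tt)
open import Data.Empty using (⊥; ⊥-elim)
open import Function using (_∘_)
open import Induction.WellFounded using (Acc; acc)
open import Relation.Nullary using (¬_; Dec; yes; no; does)
open import Relation.Nullary.Decidable using (dec-true; map′)
open import Relation.Unary using (Pred; Decidable)
open import Relation.Binary.PropositionalEquality hiding ([_])

open import Algebra.Properties.CommutativeMonoid.Sum +-0-commutativeMonoid
  using (sum-syntax; ∑-distrib-+)

sum-map-allFin : ∀ n (f : Fin n → ℕ) → sum (map f (allFin n)) ≡ ∑[ i < n ] f i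
sum-map-allFin n f = trans (cong sum (map-tabulate (λ i → i) f)) (sum-tabulate f)
  where
  sum-tabulate : ∀ {n} (f : Fin n → ℕ) → sum (tabulate f) ≡ ∑[ i < n ] f i
  sum-tabulate {zero}  f = refl
  sum-tabulate {suc n} f = cong (f zero +_) (sum-tabulate (f ∘ suc))

∑-mono-≤ : ∀ {n} {f g : Fin n → ℕ} → (∀ i → f i ≤ g i) → ∑[ i < n ] f i ≤ ∑[ i < n ] g i
∑-mono-≤ {zero}  f≤g = z≤n
∑-mono-≤ {suc n} f≤g = +-mono-≤ (f≤g zero) (∑-mono-≤ (f≤g ∘ suc))

∑-≤-* : ∀ {n} {f : Fin n → ℕ} {c} → (∀ i → f i ≤ c) → ∑[ i < n ] f i ≤ n * c
∑-≤-* {zero}  f≤c = z≤n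
∑-≤-* {suc n} f≤c = +-mono-≤ (f≤c zero) (∑-≤-* (f≤c ∘ suc))

∑-≤-0 : ∀ {n} {f : Fin n → ℕ} → (∀ i → f i ≤ 0) → ∑[ i < n ] f i ≤ 0
∑-≤-0 {n} f≤0 = ≤-trans (∑-≤-* f≤0) (≤-reflexive (*-zeroʳ n))

indicator : Bool → ℕ
indicator b = if b then 1 else 0

∑-indicator-≟≤1 : ∀ {n} (a : Fin n) → ∑[ u < n ] indicator (does (u ≟ᶠ a)) ≤ 1
∑-indicator-≟≤1 {suc n} zero    = s≤s (∑-≤-0 {n} (λ _ → z≤n))
∑-indicator-≟≤1 {suc n} (suc a) = ∑-indicator-≟≤1 a

∑-indicator-≤-length : ∀ {n} (e : Fin n → Bool) (L : List (Fin n)) →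
  (∀ u → e u ≡ true → u ∈ L) → ∑[ u < n ] indicator (e u) ≤ length L
∑-indicator-≤-length {n} e [] covered = ∑-≤-0 {n} nothing-counted
  where
  nothing-counted : ∀ u → indicator (e u) ≤ 0
  nothing-counted u with e u in eq
  ... | false = z≤n
  ... | true with () ← covered u eq
∑-indicator-≤-length {n} e (a ∷ L) covered = begin
  ∑[ u < n ] indicator (e u)                                   ≤⟨ ∑-mono-≤ split ⟩
  ∑[ u < n ] (indicator (u ≡ᵇ a) + indicator (e′ u))           ≡⟨ ∑-distrib-+ {n} _ _ ⟩
  ∑[ u < n ] indicator (u ≡ᵇ a) + ∑[ u < n ] indicator (e′ u)  ≤⟨ +-mono-≤ (∑-indicator-≟≤1 a) rest ⟩
  suc (length L)                                               ∎
  where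
  open ≤-Reasoning
  _≡ᵇ_ : Fin n → Fin n → Bool
  u ≡ᵇ a = does (u ≟ᶠ a)
  e′ : Fin n → Bool
  e′ u = e u ∧ not (u ≡ᵇ a)
  split : ∀ u → indicator (e u) ≤ indicator (u ≡ᵇ a) + indicator (e′ u)
  split u with e u | u ≟ᶠ a
  ... | false | _     = z≤n
  ... | true  | yes _ = s≤s z≤n
  ... | true  | no _  = s≤s z≤n
  covered′ : ∀ u → e′ u ≡ true → u ∈ L
  covered′ u e′u with e u in eq | u ≟ᶠ a
  covered′ u () | false | _
  covered′ u () | true  | yes _
  ... | true | no u≢a with covered u eq
  ...   | here u≡a = ⊥-elim (u≢a u≡a)
  ...   | there u∈L = u∈L
  rest : ∑[ u < n ] indicator (e′ u) ≤ length L
  rest = ∑-indicator-≤-length e′ L covered′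

module _ (G : Game) where
  open Game G

  numEdges-≤ : (succ : Fin n → List (Fin n)) → (∀ x y → edge x y ≡ true → y ∈ succ x) →
    numEdges G ≤ ∑[ x < n ] length (succ x)
  numEdges-≤ succ covered = begin
    numEdges G                                                     ≡⟨ sum-map-allFin n _ ⟩
    ∑[ x < n ] sum (map (λ y → indicator (edge x y)) (allFin n))   ≤⟨ ∑-mono-≤ out-degree ⟩
    ∑[ x < n ] length (succ x)                                     ∎
    where
    open ≤-Reasoning
    out-degree : ∀ x → sum (map (λ y → indicator (edge x y)) (allFin n)) ≤ length (succ x)
    out-degree x = ≤-trans (≤-reflexive (sum-map-allFin n _)) (∑-indicator-≤-length (edge x) (succ x) (covered x))

  costFrom-≤ : ∀ ρ k l → costFrom G ρ k l ≤ l
  costFrom-≤ ρ k zero    = z≤n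
  costFrom-≤ ρ k (suc l) with Cst (ρ k) (ρ (suc k))
  ... | ε    = m≤n⇒m≤1+n (costFrom-≤ ρ (suc k) l)
  ... | incr = s≤s (costFrom-≤ ρ (suc k) l)

  answeredWithin⇒BndCostParity : ∀ {ρ} b →
    (∀ k → ∃ λ l → l ≤ b × Ans G (Ω (ρ k)) (Ω (ρ (l + k)))) → BndCostParity G ρ
  answeredWithin⇒BndCostParity {ρ} b answered = (b , 0 , λ k _ → cor≤b k) , unanswered-impossible
    where
    cor≤b : ∀ k → CorLe G ρ k b
    cor≤b k with l , l≤b , ans ← answered k =
      l + k , m≤n+m k l , ans ,
      ≤-trans (≤-reflexive (cong (costFrom G ρ k) (m+n∸n≡m l k))) (≤-trans (costFrom-≤ ρ k l) l≤b)
    unanswered-impossible : ∀ k → ¬ UnansweredInf G ρ k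
    unanswered-impossible k (never , _) with k′ , k≤k′ , ans , _ ← cor≤b k = never k′ k≤k′ ans

  module _ {m} (𝓜 : Memory₁ G m) where
    open Memory₁ 𝓜

    memoryAlong : (ℕ → Fin n) → ℕ → Fin m
    memoryAlong ρ zero    = Init (ρ 0)
    memoryAlong ρ (suc k) = Upd (memoryAlong ρ k) (ρ (suc k))

    Upd⁺-∷ʳ : ∀ w u v → Upd⁺ (w ∷ʳ u) v ≡ Upd (Upd⁺ w u) v
    Upd⁺-∷ʳ []      u v = refl
    Upd⁺-∷ʳ (x ∷ w) u v = foldl-∷ʳ Upd (Init x) v (w ∷ʳ u)

    Upd⁺-prefix : ∀ ρ k → Upd⁺ (prefix G ρ k) (ρ k) ≡ memoryAlong ρ k
    Upd⁺-prefix ρ zero    = refl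
    Upd⁺-prefix ρ (suc k) = begin
      Upd⁺ (prefix G ρ (suc k)) (ρ (suc k))      ≡⟨ cong (λ w → Upd⁺ w (ρ (suc k))) prefix-suc ⟩
      Upd⁺ (prefix G ρ k ∷ʳ ρ k) (ρ (suc k))     ≡⟨ Upd⁺-∷ʳ (prefix G ρ k) (ρ k) (ρ (suc k)) ⟩
      Upd (Upd⁺ (prefix G ρ k) (ρ k)) (ρ (suc k)) ≡⟨ cong (λ s → Upd s (ρ (suc k))) (Upd⁺-prefix ρ k) ⟩
      memoryAlong ρ (suc k)                       ∎
      where
      open ≡-Reasoning
      prefix-suc : prefix G ρ (suc k) ≡ prefix G ρ k ∷ʳ ρ k
      prefix-suc = begin
        map ρ (applyUpTo (λ i → i) (suc k)) ≡⟨ map-applyUpTo (λ i → i) ρ (suc k) ⟩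
        applyUpTo ρ (suc k)                  ≡⟨ applyUpTo-∷ʳ ρ k ⟨
        applyUpTo ρ k ∷ʳ ρ k                 ≡⟨ cong (_∷ʳ ρ k) (map-applyUpTo (λ i → i) ρ k) ⟨
        prefix G ρ k ∷ʳ ρ k                  ∎

<⇒¬onto : ∀ {m n} → m < n → (f : Fin m → Fin n) → ¬ (∀ y → ∃ λ x → f x ≡ y)
<⇒¬onto m<n f onto = <⇒≱ m<n (injective⇒≤ {f = proj₁ ∘ onto} λ {y} {y′} e →
  trans (sym (proj₂ (onto y))) (trans (cong f e) (proj₂ (onto y′))))

<⇒∃-∉-image : ∀ {m n} → m < n → (f : Fin m → Fin n) → ∃ λ y → ∀ x → f x ≢ y
<⇒∃-∉-image {m} {n} m<n f
  with y , y∉ ← ¬∀⟶∃¬ n (λ y → ∃ λ x → f x ≡ y) (λ y → any? λ x → f x ≟ᶠ y) (<⇒¬onto m<n f) =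
  y , λ x fx≡y → y∉ (x , fx≡y)

firstFailure : ∀ {n ℓ} {P : Pred (Fin n) ℓ} → Decidable P → Fin (suc n)
firstFailure {zero}  P? = zero
firstFailure {suc n} P? with P? zero
... | yes _ = suc (firstFailure (P? ∘ suc))
... | no _  = zero

failsBefore⊎holdsAt : ∀ {n ℓ} {P : Pred (Fin n) ℓ} (P? : Decidable P) (g : Fin (suc n)) →
  firstFailure P? ≢ g → ∃ λ h → (¬ P h × toℕ h < toℕ g) ⊎ (P h × toℕ h ≡ toℕ g)
failsBefore⊎holdsAt {zero}  P? zero    ≢g = ⊥-elim (≢g refl)
failsBefore⊎holdsAt {suc n} P? g       ≢g with P? zero
failsBefore⊎holdsAt {suc n} P? zero    ≢g | no _   = ⊥-elim (≢g refl)
failsBefore⊎holdsAt {suc n} P? (suc g) ≢g | no ¬p  = zero , inj₁ (¬p , z<s)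
failsBefore⊎holdsAt {suc n} P? zero    ≢g | yes p  = zero , inj₂ (p , refl)
failsBefore⊎holdsAt {suc n} P? (suc g) ≢g | yes _
  with h , found ← failsBefore⊎holdsAt (P? ∘ suc) g (≢g ∘ cong suc) =
  suc h , Sum.map (λ (¬p , h<g) → ¬p , s<s h<g) (λ (p , h≡g) → p , cong suc h≡g) found

2∤1+2* : ∀ k → ¬ 2 ∣ suc (2 * k)
2∤1+2* k 2∣ = >⇒∤ {n = 1} (s<s z<s) (∣m+n∣m⇒∣n (subst (2 ∣_) (+-comm 1 (2 * k)) 2∣) (m∣m*n k))

<⇒1+2*≤2* : ∀ {a b} → a < b → suc (2 * a) ≤ 2 * b
<⇒1+2*≤2* {a} a<b = +-mono-≤ a<b (+-monoˡ-≤ 0 (<⇒≤ a<b))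

∀-≤-suc : ∀ {P : ℕ → Set} {a t} → (∀ x → a < x → x ≤ t → P x) → P (suc t) →
  ∀ x → a < x → x ≤ suc t → P x
∀-≤-suc below Psuc x a<x x≤1+t with m≤n⇒m<n∨m≡n x≤1+t
... | inj₁ (s≤s x≤t) = below x a<x x≤t
... | inj₂ refl      = Psuc

data Vertex (d : ℕ) : Set where
  choose                : Vertex d
  hub pay reset request : Fin d → Vertex d

vertexCount : ℕ → ℕ
vertexCount d = suc (d + (d + (d + d)))

module _ {d : ℕ} where

  toFin : Vertex d → Fin (vertexCount d)
  toFin choose      = zero
  toFin (hub i)     = suc (i ↑ˡ (d + (d + d)))
  toFin (pay i)     = suc (d ↑ʳ (i ↑ˡ (d + d)))
  toFin (reset i)   = suc (d ↑ʳ (d ↑ʳ (i ↑ˡ d)))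
  toFin (request i) = suc (d ↑ʳ (d ↑ʳ (d ↑ʳ i)))

  fromFin : Fin (vertexCount d) → Vertex d
  fromFin zero    = choose
  fromFin (suc x) = [ hub , [ pay , [ reset , request ]′ ∘ splitAt d ]′ ∘ splitAt d ]′ (splitAt d x)

  fromFin-toFin : ∀ v → fromFin (toFin v) ≡ v
  fromFin-toFin choose = refl
  fromFin-toFin (hub i)
    rewrite splitAt-↑ˡ d i (d + (d + d)) = refl
  fromFin-toFin (pay i)
    rewrite splitAt-↑ʳ d (d + (d + d)) (i ↑ˡ (d + d)) | splitAt-↑ˡ d i (d + d) = refl
  fromFin-toFin (reset i)
    rewrite splitAt-↑ʳ d (d + (d + d)) (d ↑ʳ (i ↑ˡ d)) | splitAt-↑ʳ d (d + d) (i ↑ˡ d)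
          | splitAt-↑ˡ d i d = refl
  fromFin-toFin (request i)
    rewrite splitAt-↑ʳ d (d + (d + d)) (d ↑ʳ (d ↑ʳ i)) | splitAt-↑ʳ d (d + d) (d ↑ʳ i)
          | splitAt-↑ʳ d d i = refl

  toFin-fromFin : ∀ x → toFin (fromFin x) ≡ x
  toFin-fromFin zero = refl
  toFin-fromFin (suc x) with splitAt d x in eq₁
  ... | inj₁ i = cong suc (splitAt⁻¹-↑ˡ eq₁)
  ... | inj₂ y with splitAt d y in eq₂
  ...   | inj₁ i = cong suc (trans (cong (d ↑ʳ_) (splitAt⁻¹-↑ˡ eq₂)) (splitAt⁻¹-↑ʳ eq₁))
  ...   | inj₂ z with splitAt d z in eq₃
  ...     | inj₁ i = cong suc (trans (cong (λ w → d ↑ʳ (d ↑ʳ w)) (splitAt⁻¹-↑ˡ eq₃))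
                                (trans (cong (d ↑ʳ_) (splitAt⁻¹-↑ʳ eq₂)) (splitAt⁻¹-↑ʳ eq₁)))
  ...     | inj₂ i = cong suc (trans (cong (λ w → d ↑ʳ (d ↑ʳ w)) (splitAt⁻¹-↑ʳ eq₃))
                                (trans (cong (d ↑ʳ_) (splitAt⁻¹-↑ʳ eq₂)) (splitAt⁻¹-↑ʳ eq₁)))

  _≟ᵛ_ : (u v : Vertex d) → Dec (u ≡ v)
  u ≟ᵛ v = map′ (λ e → trans (sym (fromFin-toFin u)) (trans (cong fromFin e) (fromFin-toFin v)))
                (cong toFin) (toFin u ≟ᶠ toFin v)

  open import Data.List.Membership.DecPropositional _≟ᵛ_ using (_∈?_)

  succs : Vertex d → List (Vertex d)
  succs choose      = map hub (allFin d)
  succs (hub i)     = pay i ∷ reset i ∷ []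
  succs (pay _)     = [ choose ]
  succs (reset i)   = [ request i ]
  succs (request _) = [ choose ]

  edge : Vertex d → Vertex d → Bool
  edge u v = does (v ∈? succs u)

  edge⇒∈ : ∀ {u v} → edge u v ≡ true → v ∈ succs u
  edge⇒∈ {u} {v} e with v ∈? succs u
  ... | yes v∈ = v∈

  ∈⇒edge : ∀ {u v} → v ∈ succs u → edge u v ≡ true
  ∈⇒edge {u} {v} = dec-true (v ∈? succs u)

  owner : Vertex d → Player
  owner (hub _) = P1
  owner _       = P0

  color : Vertex d → ℕ
  color choose      = 0
  color (hub _)     = 0
  color (pay i)     = 2 * toℕ i
  color (reset _)   = 2 * d
  color (request i) = suc (2 * toℕ i)

  cost : Vertex d → Vertex d → CostLabel
  cost (pay _) _ = incr
  cost _       _ = ε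

𝒢 : (d : ℕ) → .{{NonZero d}} → Game
𝒢 d = record
  { n     = vertexCount d
  ; owner = owner ∘ fromFin {d}
  ; edge  = λ x y → edge (fromFin {d} x) (fromFin y)
  ; total = total
  ; Ω     = color ∘ fromFin {d}
  ; Cst   = λ x y → cost (fromFin {d} x) (fromFin y)
  }
  where
  successor : (v : Vertex d) → ∃ λ u → u ∈ succs v
  successor choose      = hub i₀ , ∈-map⁺ hub (∈-allFin i₀)
    where i₀ = fromℕ< (>-nonZero⁻¹ d)
  successor (hub i)     = pay i , here refl
  successor (pay _)     = choose , here refl
  successor (reset i)   = request i , here refl
  successor (request _) = choose , here refl

  total : ∀ x → ∃ λ y → edge (fromFin {d} x) (fromFin y) ≡ true
  total x with u , u∈ ← successor (fromFin x) =
    toFin u , ∈⇒edge {u = fromFin x} (subst (_∈ succs (fromFin x)) (sym (fromFin-toFin u)) u∈)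

length-succs : ∀ {d} (v : Vertex d) → v ≢ choose → length (succs v) ≤ 2
length-succs choose      v≢choose = ⊥-elim (v≢choose refl)
length-succs (hub _)     _        = ≤-refl
length-succs (pay _)     _        = s≤s z≤n
length-succs (reset _)   _        = s≤s z≤n
length-succs (request _) _        = s≤s z≤n

arenaSize-𝒢 : ∀ d .{{_ : NonZero d}} → arenaSize (𝒢 d) ≤ 14 * d
arenaSize-𝒢 d = begin
  vertexCount d + numEdges (𝒢 d)                 ≤⟨ +-monoʳ-≤ (vertexCount d) edges ⟩
  vertexCount d + (d + (d + (d + (d + d))) * 2)  ≡⟨ linear d ⟩
  1 + 13 * d                                     ≤⟨ +-monoˡ-≤ (13 * d) (>-nonZero⁻¹ d) ⟩
  14 * d                                         ∎
  where
  open ≤-Reasoning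
  open +-*-Solver
  linear : ∀ d → vertexCount d + (d + (d + (d + (d + d))) * 2) ≡ 1 + 13 * d
  linear = solve 1 (λ d → (con 1 :+ (d :+ (d :+ (d :+ d)))) :+ (d :+ (d :+ (d :+ (d :+ d))) :* con 2)
                          := con 1 :+ con 13 :* d) refl
  successors : Fin (vertexCount d) → List (Fin (vertexCount d))
  successors x = map toFin (succs (fromFin {d} x))
  covered : ∀ x y → Game.edge (𝒢 d) x y ≡ true → y ∈ successors x
  covered x y e = subst (_∈ successors x) (toFin-fromFin y) (∈-map⁺ toFin (edge⇒∈ {u = fromFin {d} x} e))
  choose-degree : length (successors zero) ≡ d
  choose-degree = trans (length-map toFin (map hub (allFin d)))
                       (trans (length-map hub (allFin d)) (length-tabulate (λ i → i)))
  other-degree : ∀ x → length (successors (suc x)) ≤ 2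
  other-degree x =
    ≤-trans (≤-reflexive (length-map toFin (succs (fromFin {d} (suc x))))) (length-succs _ not-choose)
    where
    not-choose : fromFin {d} (suc x) ≢ choose
    not-choose e = zero≢suc (sym (trans (sym (toFin-fromFin (suc x))) (cong toFin e)))
  edges : numEdges (𝒢 d) ≤ d + (d + (d + (d + d))) * 2
  edges = begin
    numEdges (𝒢 d)                                ≤⟨ numEdges-≤ (𝒢 d) successors covered ⟩
    ∑[ x < vertexCount d ] length (successors x)  ≤⟨ +-mono-≤ (≤-reflexive choose-degree) (∑-≤-* other-degree) ⟩
    d + (d + (d + (d + d))) * 2                   ∎

odd-color⇒request : ∀ {d} (v : Vertex d) → ¬ 2 ∣ color v → ∃ λ i → v ≡ request i
odd-color⇒request     choose      odd = ⊥-elim (odd (m∣m*n 0))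
odd-color⇒request     (hub _)     odd = ⊥-elim (odd (m∣m*n 0))
odd-color⇒request     (pay i)     odd = ⊥-elim (odd (m∣m*n (toℕ i)))
odd-color⇒request {d} (reset _)   odd = ⊥-elim (odd (m∣m*n d))
odd-color⇒request     (request i) _   = i , refl

oddColors-𝒢 : ∀ d .{{_ : NonZero d}} → HasOddColorCount (𝒢 d) d
oddColors-𝒢 d = map (color ∘ request) (allFin d) ,
                trans (length-map _ (allFin d)) (length-tabulate (λ i → i)) ,
                Unique-map⁺ request-color-injective (allFin⁺ d) ,
                λ c → listed⇒odd-color c , odd-color⇒listed c
  where
  request-color-injective : ∀ {i j} → color (request {d} i) ≡ color (request j) → i ≡ j
  request-color-injective e = toℕ-injective (*-cancelˡ-≡ _ _ 2 (suc-injective e))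
  listed⇒odd-color : ∀ c → c ∈ map (color ∘ request) (allFin d) →
    ¬ 2 ∣ c × ∃ λ x → color (fromFin {d} x) ≡ c
  listed⇒odd-color c c∈ with i , _ , refl ← ∈-map⁻ (color ∘ request) c∈ =
    2∤1+2* (toℕ i) , toFin (request i) , cong color (fromFin-toFin (request i))
  odd-color⇒listed : ∀ c → ¬ 2 ∣ c × ∃ (λ x → color (fromFin {d} x) ≡ c) →
    c ∈ map (color ∘ request) (allFin d)
  odd-color⇒listed c (odd , x , refl) with i , eq ← odd-color⇒request (fromFin x) odd =
    subst (λ v → color v ∈ map (color ∘ request) (allFin d)) (sym eq)
      (∈-map⁺ (color ∘ request) (∈-allFin i))

module _ {d : ℕ} where

  rememberRequest : Fin (suc d) → Vertex d → Fin (suc d)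
  rememberRequest _ (request i) = suc i
  rememberRequest q _           = q

  respond : Fin d → Fin (suc d) → Vertex d
  respond i q with toℕ i <? toℕ q
  ... | yes _ = pay i
  ... | no _  = reset i

  respond-cases : ∀ i q →
    (toℕ i < toℕ q × respond i q ≡ pay i) ⊎ (toℕ q ≤ toℕ i × respond i q ≡ reset i)
  respond-cases i q with toℕ i <? toℕ q
  ... | yes i<q = inj₁ (i<q , refl)
  ... | no  i≮q = inj₂ (≮⇒≥ i≮q , refl)

  reply : Vertex d → Fin (suc d) → Vertex d
  reply (hub i) q = respond i q
  reply v       _ = v  -- only consulted at hubs, the vertices of Player 1

  reply-legal : ∀ v q → owner v ≡ P1 → reply v q ∈ succs v
  reply-legal (hub i) q _ with respond-cases i q
  ... | inj₁ (_ , e) = subst (_∈ succs (hub i)) (sym e) (here refl)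
  ... | inj₂ (_ , e) = subst (_∈ succs (hub i)) (sym e) (there (here refl))

strategy₁ : ∀ d .{{_ : NonZero d}} → Memory₁ (𝒢 d) (suc d)
strategy₁ d = record
  { Init      = rememberRequest zero ∘ fromFin
  ; Upd       = λ q x → rememberRequest q (fromFin x)
  ; Nxt       = λ x q → toFin (reply (fromFin {d} x) q)
  ; Nxt-legal = λ x q p → ∈⇒edge {u = fromFin {d} x}
                  (subst (_∈ succs (fromFin x)) (sym (fromFin-toFin _)) (reply-legal (fromFin x) q p))
  }

module Strategy₁Wins (d : ℕ) .{{_ : NonZero d}} (ρ : ℕ → Fin (vertexCount d))
  (ρ-play : IsPlay (𝒢 d) ρ) (ρ-consistent : Consistent₁ (𝒢 d) (implemented (𝒢 d) (strategy₁ d)) ρ)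
  (no-unanswered : ∀ k → ¬ UnansweredInf (𝒢 d) ρ k) where

  v : ℕ → Vertex d
  v k = fromFin (ρ k)

  q : ℕ → Fin (suc d)
  q = memoryAlong (𝒢 d) (strategy₁ d) ρ

  successor : ∀ {k u} → v k ≡ u → v (suc k) ∈ succs u
  successor {k} refl = edge⇒∈ {u = v k} (ρ-play k)

  choose→hub : ∀ {k} → v k ≡ choose → ∃ λ i → v (suc k) ≡ hub i
  choose→hub e with i , _ , eq ← ∈-map⁻ hub (successor e) = i , eq

  pay→choose : ∀ {k i} → v k ≡ pay i → v (suc k) ≡ choose
  pay→choose e = singleton⁻ (successor e)

  reset→request : ∀ {k i} → v k ≡ reset i → v (suc k) ≡ request i
  reset→request e = singleton⁻ (successor e)

  request→choose : ∀ {k i} → v k ≡ request i → v (suc k) ≡ choose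
  request→choose e = singleton⁻ (successor e)

  hub→respond : ∀ {k i} → v k ≡ hub i → v (suc k) ≡ respond i (q k)
  hub→respond {k} e = trans (cong fromFin (ρ-consistent k (cong owner e)))
    (trans (fromFin-toFin _) (cong₂ reply e (Upd⁺-prefix (𝒢 d) (strategy₁ d) ρ k)))

  record Pending (j : Fin d) (k₀ t : ℕ) : Set where
    field
      issued     : v k₀ ≡ request j
      at-choose  : v t ≡ choose
      remembered : q t ≡ suc j
      k₀<t       : k₀ < t
      below      : ∀ x → k₀ < x → x ≤ t → color (v x) ≤ 2 * toℕ j

  color≤ : ∀ {x w c} → v x ≡ w → color w ≤ c → color (v x) ≤ c
  color≤ e = subst (λ u → color u ≤ _) (sym e)

  pending-start : ∀ {j k} → v k ≡ request j → q k ≡ suc j → Pending j k (suc k)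
  pending-start {k = k} issued remembered = record
    { issued     = issued
    ; at-choose  = request→choose issued
    ; remembered = trans (cong (rememberRequest (q k)) (request→choose issued)) remembered
    ; k₀<t       = ≤-refl
    ; below      = ∀-≤-suc (λ x k<x x≤k → ⊥-elim (<⇒≱ k<x x≤k)) (color≤ (request→choose issued) z≤n)
    }

  entered-hub : ∀ {j k₀ t} → Pending j k₀ t →
    ∃ λ i → v (suc t) ≡ hub i × v (2 + t) ≡ respond i (suc j)
  entered-hub {t = t} p with i , v₁ ← choose→hub (Pending.at-choose p) =
    i , v₁ , trans (hub→respond v₁)
               (cong (respond i) (trans (cong (rememberRequest (q t)) v₁) (Pending.remembered p)))

  data Outcome (j : Fin d) (k₀ t : ℕ) : Set where
    stays   : ∀ {i} → v (2 + t) ≡ pay i → Pending j k₀ (3 + t) → Outcome j k₀ t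
    escapes : ∀ {i} → toℕ j < toℕ i → v (3 + t) ≡ request i → q (3 + t) ≡ suc i → Outcome j k₀ t

  round : ∀ {j k₀ t} → Pending j k₀ t → Outcome j k₀ t
  round {j} {k₀} {t} p with entered-hub p
  ... | i , v₁ , v₂ with respond-cases i (suc j)
  ...   | inj₁ (i≤j , r) = stays paid record
    { issued     = issued
    ; at-choose  = back
    ; remembered = trans (cong (rememberRequest _) back) (trans (cong (rememberRequest _) paid)
                     (trans (cong (rememberRequest (q t)) v₁) remembered))
    ; k₀<t       = <-≤-trans k₀<t (m≤n+m t 3)
    ; below      = ∀-≤-suc (∀-≤-suc (∀-≤-suc below (color≤ v₁ z≤n))
                     (color≤ paid (*-monoʳ-≤ 2 (s≤s⁻¹ i≤j)))) (color≤ back z≤n)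
    }
    where
    open Pending p
    paid : v (2 + t) ≡ pay i
    paid = trans v₂ r
    back : v (3 + t) ≡ choose
    back = pay→choose paid
  ...   | inj₂ (j<i , r) = escapes j<i requested (cong (rememberRequest _) requested)
    where
    requested : v (3 + t) ≡ request i
    requested = reset→request (trans v₂ r)

  -- Downward induction on j: a round that does not pay opens a strictly larger request.
  refute : ∀ {j} → Acc Fin._>_ j → ∀ {k₀} → v k₀ ≡ request j → q k₀ ≡ suc j → ⊥
  refute {j} (acc larger) {k₀} issued remembered = no-unanswered k₀ (never-answered , pays-forever)
    where
    next-round : ∀ {t} → Pending j k₀ t → (∃ λ i → v (2 + t) ≡ pay i) × Pending j k₀ (3 + t)
    next-round p with round p
    ... | stays paid p′                        = (_ , paid) , p′
    ... | escapes j<i issued′ remembered′ = ⊥-elim (refute (larger j<i) issued′ remembered′)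

    roundStart : ℕ → ℕ
    roundStart zero    = suc k₀
    roundStart (suc r) = 3 + roundStart r

    pending : ∀ r → Pending j k₀ (roundStart r)
    pending zero    = pending-start issued remembered
    pending (suc r) = proj₂ (next-round (pending r))

    r≤roundStart : ∀ r → r ≤ roundStart r
    r≤roundStart zero    = z≤n
    r≤roundStart (suc r) = s≤s (≤-trans (r≤roundStart r) (m≤n+m _ 2))

    never-answered : ∀ k → k₀ ≤ k → ¬ Ans (𝒢 d) (color (v k₀)) (color (v k))
    never-answered k k₀≤k (request≤c , even) with m≤n⇒m<n∨m≡n k₀≤k
    ... | inj₂ refl = 2∤1+2* (toℕ j) (subst (λ w → 2 ∣ color w) issued even)
    ... | inj₁ k₀<k = 1+n≰n (≤-trans (subst (λ w → color w ≤ color (v k)) issued request≤c)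
                                      (Pending.below (pending k) k k₀<k (r≤roundStart k)))

    pays-forever : ∀ m → ∃ λ k → m ≤ k × k₀ ≤ k × cost (v k) (v (suc k)) ≡ incr
    pays-forever m with (i , paid) , _ ← next-round (pending m) =
      2 + roundStart m , ≤-trans (r≤roundStart m) (m≤n+m _ 2) ,
      ≤-trans (<⇒≤ (Pending.k₀<t (pending m))) (m≤n+m _ 2) ,
      cong (λ w → cost w (v (3 + roundStart m))) paid

  refute-reset : ∀ {k i} → v k ≡ reset i → ⊥
  refute-reset {k} {i} e =
    refute (>-wellFounded i) (reset→request e) (cong (rememberRequest (q k)) (reset→request e))

  refute-hub : ∀ {k i} → v k ≡ hub i → q k ≡ zero → ⊥
  refute-hub {k} {i} e q≡0 with respond-cases i zero
  ... | inj₂ (_ , r) = refute-reset (trans (hub→respond e) (trans (cong (respond i) q≡0) r))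

  refute-choose : ∀ {k} → v k ≡ choose → q k ≡ zero → ⊥
  refute-choose {k} e q≡0 with _ , h ← choose→hub e =
    refute-hub h (trans (cong (rememberRequest (q k)) h) q≡0)

  impossible : ⊥
  impossible = from (v 0) refl
    where
    from : ∀ u → v 0 ≡ u → ⊥
    from choose      e = refute-choose e (cong (rememberRequest zero) e)
    from (hub _)     e = refute-hub e (cong (rememberRequest zero) e)
    from (pay _)     e = refute-choose (pay→choose e)
                           (trans (cong (rememberRequest (q 0)) (pay→choose e)) (cong (rememberRequest zero) e))
    from (reset _)   e = refute-reset e
    from (request i) e = refute (>-wellFounded i) e (cong (rememberRequest zero) e)

strategy₁-wins : ∀ d .{{_ : NonZero d}} x →
  WinningFrom₁ (𝒢 d) (implemented (𝒢 d) (strategy₁ d)) x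
strategy₁-wins d _ ρ ρ-play _ ρ-consistent (_ , no-unanswered) =
  Strategy₁Wins.impossible d ρ ρ-play ρ-consistent no-unanswered

module SmallMemoryLoses (d : ℕ) .{{_ : NonZero d}} {m : ℕ} (m<1+d : m < suc d)
  (𝓜 : Memory₁ (𝒢 d) m) where
  open Memory₁ 𝓜

  answer : Fin m → Fin d → Vertex d
  answer s i = fromFin (Nxt (toFin (hub i)) (Upd s (toFin (hub i))))

  answer-legal : ∀ s i → answer s i ∈ succs (hub i)
  answer-legal s i = edge⇒∈ {u = hub i}
    (subst (λ u → edge u (answer s i) ≡ true) (fromFin-toFin (hub i))
      (Nxt-legal (toFin (hub i)) (Upd s (toFin (hub i))) (cong owner (fromFin-toFin (hub i)))))

  pays? : ∀ s → Decidable (λ i → answer s i ≡ pay i)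
  pays? s i = answer s i ≟ᵛ pay i

  missed : ∃ λ g → ∀ s → firstFailure (pays? s) ≢ g
  missed = <⇒∃-∉-image m<1+d (λ s → firstFailure (pays? s))

  g : Fin (suc d)
  g = proj₁ missed

  Harmless : Fin d → Vertex d → Set
  Harmless h w = (w ≡ reset h × toℕ h < toℕ g) ⊎ (w ≡ pay h × toℕ h ≡ toℕ g)

  target : ∀ s → ∃ λ h → Harmless h (answer s h)
  target s with h , found ← failsBefore⊎holdsAt (pays? s) g (proj₂ missed s) =
    h , Sum.map₁ (λ (¬pays , h<g) → reset-if-not-pay (answer-legal s h) ¬pays , h<g) found
    where
    reset-if-not-pay : ∀ {h w} → w ∈ succs (hub h) → w ≢ pay h → w ≡ reset h
    reset-if-not-pay (here w≡pay)         w≢pay = ⊥-elim (w≢pay w≡pay)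
    reset-if-not-pay (there (here w≡reset)) _   = w≡reset

  hubOf : Fin m → Fin d
  hubOf s = proj₁ (target s)

  move : Vertex d → Fin (vertexCount d) → Fin m → Fin (vertexCount d)
  move choose      _ s = toFin (hub (hubOf s))
  move (hub _)     x s = Nxt x s
  move (pay _)     _ _ = toFin {d} choose
  move (reset i)   _ _ = toFin (request i)
  move (request _) _ _ = toFin {d} choose

  step : Fin (vertexCount d) × Fin m → Fin (vertexCount d) × Fin m
  step (x , s) = move (fromFin x) x s , Upd s (move (fromFin x) x s)

  history : ℕ → Fin (vertexCount d) × Fin m
  history zero    = toFin {d} choose , Init (toFin {d} choose)
  history (suc k) = step (history k)

  ρ : ℕ → Fin (vertexCount d)
  ρ k = proj₁ (history k)

  mem : ℕ → Fin m
  mem k = proj₂ (history k)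

  v : ℕ → Vertex d
  v k = fromFin (ρ k)

  memoryAlong≡mem : ∀ k → memoryAlong (𝒢 d) 𝓜 ρ k ≡ mem k
  memoryAlong≡mem zero    = refl
  memoryAlong≡mem (suc k) = cong (λ t → Upd t (ρ (suc k))) (memoryAlong≡mem k)

  consistent : Consistent₁ (𝒢 d) (implemented (𝒢 d) 𝓜) ρ
  consistent k p = trans (move-P1 (v k) p)
    (cong (Nxt (ρ k)) (sym (trans (Upd⁺-prefix (𝒢 d) 𝓜 ρ k) (memoryAlong≡mem k))))
    where
    move-P1 : ∀ u → owner u ≡ P1 → move u (ρ k) (mem k) ≡ Nxt (ρ k) (mem k)
    move-P1 (hub _) _ = refl

  move-legal : ∀ u x t → fromFin x ≡ u → fromFin (move u x t) ∈ succs u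
  move-legal choose      x t _ rewrite fromFin-toFin (hub (hubOf t)) = ∈-map⁺ hub (∈-allFin (hubOf t))
  move-legal (hub i)     x t e = subst (λ u → fromFin (Nxt x t) ∈ succs u) e
                                   (edge⇒∈ {u = fromFin x} (Nxt-legal x t (cong owner e)))
  move-legal (pay _)     x t _ = here refl
  move-legal (reset i)   x t _ rewrite fromFin-toFin (request i) = here refl
  move-legal (request _) x t _ = here refl

  is-play : IsPlay (𝒢 d) ρ
  is-play k = ∈⇒edge {u = v k} (move-legal (v k) (ρ k) (mem k) refl)

  Inv : Vertex d → Fin (vertexCount d) → Fin m → Set
  Inv (hub h)     x t = Harmless h (fromFin (Nxt x t))
  Inv (reset i)   _ _ = toℕ i < toℕ g
  Inv (request i) _ _ = toℕ i < toℕ g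
  Inv _           _ _ = ⊤

  Inv-step : ∀ u x t → Inv u x t → Inv (fromFin (move u x t)) (move u x t) (Upd t (move u x t))
  Inv-step choose      x t _ rewrite fromFin-toFin (hub (hubOf t)) = proj₂ (target t)
  Inv-step (hub h)     x t (inj₁ (e , h<g)) = subst (λ w → Inv w _ (Upd t (Nxt x t))) (sym e) h<g
  Inv-step (hub h)     x t (inj₂ (e , _))   = subst (λ w → Inv w _ (Upd t (Nxt x t))) (sym e) tt
  Inv-step (pay _)     x t _   = tt
  Inv-step (reset i)   x t i<g rewrite fromFin-toFin (request i) = i<g
  Inv-step (request _) x t _   = tt

  invariant : ∀ k → Inv (v k) (ρ k) (mem k)
  invariant zero    = tt
  invariant (suc k) = Inv-step (v k) (ρ k) (mem k) (invariant k)

  invariant-at : ∀ k {u} → v k ≡ u → Inv u (ρ k) (mem k)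
  invariant-at k e = subst (λ u → Inv u (ρ k) (mem k)) e (invariant k)

  after : ∀ k {u} → v k ≡ u → v (suc k) ≡ fromFin (move u (ρ k) (mem k))
  after k = cong (λ u → fromFin (move u (ρ k) (mem k)))

  AnsweredSoon : ℕ → Set
  AnsweredSoon k = ∃ λ l → l ≤ 3 × Ans (𝒢 d) (color (v k)) (color (v (l + k)))

  even-answered : ∀ {k} → 2 ∣ color (v k) → AnsweredSoon k
  even-answered even = 0 , z≤n , ≤-refl , even

  request-answered : ∀ {k i} → v k ≡ request i → AnsweredSoon k
  request-answered {k} {i} e =
    3 , ≤-refl , subst (λ c → Ans (𝒢 d) c (color (v (3 + k)))) (sym (cong color e)) answered₃
    where
    i<g : toℕ i < toℕ g
    i<g = invariant-at k e
    h : Fin d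
    h = hubOf (mem (suc k))
    at-hub : v (2 + k) ≡ hub h
    at-hub = trans (after (suc k) (after k e)) (fromFin-toFin (hub h))
    harmless : Harmless h (v (3 + k))
    harmless = subst (Harmless h) (sym (after (2 + k) at-hub)) (invariant-at (2 + k) at-hub)
    answered₃ : Ans (𝒢 d) (suc (2 * toℕ i)) (color (v (3 + k)))
    answered₃ with harmless
    ... | inj₁ (e₃ , _)   rewrite e₃ = <⇒1+2*≤2* (toℕ<n i) , m∣m*n d
    ... | inj₂ (e₃ , h≡g) rewrite e₃ = <⇒1+2*≤2* (subst (toℕ i <_) (sym h≡g) i<g) , m∣m*n (toℕ h)

  answered : ∀ k → AnsweredSoon k
  answered k = from (v k) refl
    where
    from : ∀ u → v k ≡ u → AnsweredSoon k
    from choose      e = even-answered (subst (λ w → 2 ∣ color w) (sym e) (m∣m*n 0))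
    from (hub _)     e = even-answered (subst (λ w → 2 ∣ color w) (sym e) (m∣m*n 0))
    from (pay i)     e = even-answered (subst (λ w → 2 ∣ color w) (sym e) (m∣m*n (toℕ i)))
    from (reset _)   e = even-answered (subst (λ w → 2 ∣ color w) (sym e) (m∣m*n d))
    from (request _) e = request-answered e

  loses : ¬ WinningFrom₁ (𝒢 d) (implemented (𝒢 d) 𝓜) (toFin {d} choose)
  loses winning = winning ρ is-play refl consistent (answeredWithin⇒BndCostParity (𝒢 d) 3 answered)

lemma3p8 : ∃ λ (c : ℕ) → ∀ (d : ℕ) → 1 ≤ d →
    Σ Game λ G →
      (arenaSize G ≤ c * d) ×
      HasOddColorCount G d ×
      (Σ (Memory₁ G (suc d)) λ 𝓜 → ∀ v → WinningFrom₁ G (implemented G 𝓜) v) ×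
      (∃ λ v → ∀ (m : ℕ) → m < suc d → (𝓜 : Memory₁ G m) → ¬ WinningFrom₁ G (implemented G 𝓜) v)
lemma3p8 = 14 , λ where
  d@(suc _) _ → 𝒢 d , arenaSize-𝒢 d , oddColors-𝒢 d , (strategy₁ d , strategy₁-wins d) ,
                (toFin {d} choose , λ m m<1+d 𝓜 → SmallMemoryLoses.loses d m<1+d 𝓜)
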